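{- For all $\lambda$-terms: (1) Merge: if $t\Rightarrow_{\neg\ell\ell}s\to_{\ell\ell}u$ then $t\Rightarrow_\beta u$. (2) Indexed split: if $t\Rightarrow_\beta^ns$ then either $t\Rightarrow_{\neg\ell\ell}s$, or $n>0$ and $t\to_{\ell\ell}r\Rightarrow_\beta^{n-1}s$ for some $r$. (3) Split: if $t\Rightarrow_\beta s$ then $t\to_{\ell\ell}^*r\Rightarrow_{\neg\ell\ell}s$ for some $r$. Consequently $(\Lambda,\{\to_{\ell\ell},\to_{\neg\ell\ell}\})$ is a macro-step system with respect to $\Rightarrow_\beta$ and $\Rightarrow_{\neg\ell\ell}$.
   Context: $\Lambda$ is the set of $\lambda$-terms $t::=x\mid\lambda x.t\mid ts$ (up to $\alpha$-equivalence); $t\{x:=s\}$ capture-avoiding substitution; $|t|_x$ number of free occurrences of $x$ in $t$. $\beta$-reduction of level $k\in\mathbb N$: $(\lambda x.t)s\to_{\beta:0}t\{x:=s\}$; if $t\to_{\beta:k}t'$ then $\lambda x.t\to_{\beta:k}\lambda x.t'$, $ts\to_{\beta:k}t's$, $st\to_{\beta:k+1}st'$. Least level: $\mathrm{deg}(x)=\infty$, $\mathrm{deg}(\lambda x.t)=\mathrm{deg}(t)$, $\mathrm{deg}(ts)=0$ if $t$ is an abstraction, else $\min\{\mathrm{deg}(t),\mathrm{deg}(s)+1\}$ ($\infty+1=\infty$). $t\to_{\ell\ell}s$ iff $t\to_{\beta:k}s$ with $k=\mathrm{deg}(t)$; $t\to_{\neg\ell\ell}s$ iff $t\to_{\beta:k}s$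 with $\mathrm{deg}(t)<k\in\mathbb N$. Parallel $\beta$ of least level $n\in\mathbb N\cup\{\infty\}$, $\Rightarrow_{\beta:n}$: $x\Rightarrow_{\beta:\infty}x$; if $t\Rightarrow_{\beta:k}t'$ and $s\Rightarrow_{\beta:h}s'$ then $(\lambda x.t)s\Rightarrow_{\beta:0}t'\{x:=s'\}$ and $ts\Rightarrow_{\beta:\min\{k,h+1\}}t's'$; if $t\Rightarrow_{\beta:k}t'$ then $\lambda x.t\Rightarrow_{\beta:k}\lambda x.t'$. $t\Rightarrow_{\neg\ell\ell}s$ iff $t\Rightarrow_{\beta:k}s$ with $k=\infty$ or $k>\mathrm{deg}(t)$. Indexed parallel $\beta$ $\Rightarrow_\beta^n$ ($n\in\mathbb N$): $x\Rightarrow_\beta^0x$; $t\Rightarrow_\beta^nt'$ gives $\lambda x.t\Rightarrow_\beta^n\lambda x.t'$; $t\Rightarrow_\beta^nt'$, $s\Rightarrow_\beta^ms'$ give $ts\Rightarrow_\beta^{n+m}t's'$ and $(\lambda x.t)s\Rightarrow_\beta^{n+|t'|_x\cdot m+1}t'\{x:=s'\}$; $\Rightarrow_\beta=\bigcup_n\Rightarrow_\beta^n$. A system $(S,\{\to_e,\to_{\neg e}\})$ is a macro-step system w.r.t. $\Rightarrow,\Rightarrow_{\neg e}$ if $\to_{\neg e}\subseteq\Rightarrow_{\neg e}\subseteq\to_{\neg e}^*$, $t\Rightarrow_{\neg e}\cdot\to_eu$ implies $t\Rightarrow u$, and $t\Rightarrow u$ implies $t\to_e^*\cdot\Rightarrow_{\neg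 e}u$. -}

module Defs where

open import Data.Nat using (ℕ; zero; suc; _+_; _*_; _<_)
open import Data.Nat as N using ()
open import Data.Bool using (if_then_else_)
open import Data.Product using (Σ; _×_; ∃; ∃-syntax; _,_)
open import Data.Sum using (_⊎_)
open import Relation.Binary.PropositionalEquality using (_≡_)
open import Relation.Binary.Construct.Closure.ReflexiveTransitive using (Star)
open import Relation.Nullary.Decidable using (⌊_⌋)

-- λ-terms up to α-equivalence: de Bruijn indices (free variables are indices ≥ binder depth)
data Term : Set where
  var : ℕ → Term
  lam : Term → Term
  app : Term → Term → Term

ext : (ℕ → ℕ) → ℕ → ℕ
ext ρ zero = zero
ext ρ (suc n) = suc (ρ n)

ren : (ℕ → ℕ) → Term → Term
ren ρ (var x) = var (ρ x)
ren ρ (lam t) = lam (ren (ext ρ) t)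
ren ρ (app t s) = app (ren ρ t) (ren ρ s)

exts : (ℕ → Term) → ℕ → Term
exts σ zero = var zero
exts σ (suc n) = ren suc (σ n)

sub : (ℕ → Term) → Term → Term
sub σ (var x) = σ x
sub σ (lam t) = lam (sub (exts σ) t)
sub σ (app t s) = app (sub σ t) (sub σ s)

-- t [ s ] : substitute s for the bound variable 0 of the body t (i.e. t{x:=s})
single : Term → ℕ → Term
single s zero = s
single s (suc n) = var n

_[_] : Term → Term → Term
t [ s ] = sub (single s) t

occ : ℕ → Term → ℕ
occ x (var y) = if ⌊ x N.≟ y ⌋ then 1 else 0
occ x (lam t) = occ (suc x) t
occ x (app t s) = occ x t + occ x s

data ℕ∞ : Set where
  fin : ℕ → ℕ∞
  ∞ : ℕ∞

min∞ : ℕ∞ → ℕ∞ → ℕ∞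
min∞ (fin m) (fin n) = fin (N._⊓_ m n)
min∞ (fin m) ∞ = fin m
min∞ ∞ n = n

suc∞ : ℕ∞ → ℕ∞
suc∞ (fin n) = fin (suc n)
suc∞ ∞ = ∞

data _<∞_ : ℕ∞ → ℕ∞ → Set where
  fin<fin : ∀ {m n} → m < n → fin m <∞ fin n
  fin<∞ : ∀ {m} → fin m <∞ ∞

deg : Term → ℕ∞
deg (var x) = ∞
deg (lam t) = deg t
deg (app (lam t) s) = fin 0
deg (app (var x) s) = min∞ (deg (var x)) (suc∞ (deg s))
deg (app (app t₁ t₂) s) = min∞ (deg (app t₁ t₂)) (suc∞ (deg s))

data _→β[_]_ : Term → ℕ → Term → Set where
  β-root : ∀ {t s} → app (lam t) s →β[ 0 ] (t [ s ])
  β-lam  : ∀ {t t' k} → t →β[ k ] t' → lam t →β[ k ] lam t'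
  β-appL : ∀ {t t' s k} → t →β[ k ] t' → app t s →β[ k ] app t' s
  β-appR : ∀ {t t' s k} → t →β[ k ] t' → app s t →β[ suc k ] app s t'

_→ℓℓ_ : Term → Term → Set
t →ℓℓ s = Σ ℕ λ k → (t →β[ k ] s) × (fin k ≡ deg t)

_→¬ℓℓ_ : Term → Term → Set
t →¬ℓℓ s = Σ ℕ λ k → (t →β[ k ] s) × (deg t <∞ fin k)

data _⇒β[_]_ : Term → ℕ∞ → Term → Set where
  p-var  : ∀ {x} → var x ⇒β[ ∞ ] var x
  p-beta : ∀ {t t' s s' k h} → t ⇒β[ k ] t' → s ⇒β[ h ] s' →
           app (lam t) s ⇒β[ fin 0 ] (t' [ s' ])
  p-app  : ∀ {t t' s s' k h} → t ⇒β[ k ] t' → s ⇒β[ h ] s' →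
           app t s ⇒β[ min∞ k (suc∞ h) ] app t' s'
  p-lam  : ∀ {t t' k} → t ⇒β[ k ] t' → lam t ⇒β[ k ] lam t'

_⇒¬ℓℓ_ : Term → Term → Set
t ⇒¬ℓℓ s = Σ ℕ∞ λ k → (t ⇒β[ k ] s) × (k ≡ ∞ ⊎ deg t <∞ k)

data _⇒β^[_]_ : Term → ℕ → Term → Set where
  i-var  : ∀ {x} → var x ⇒β^[ 0 ] var x
  i-lam  : ∀ {t t' n} → t ⇒β^[ n ] t' → lam t ⇒β^[ n ] lam t'
  i-app  : ∀ {t t' s s' n m} → t ⇒β^[ n ] t' → s ⇒β^[ m ] s' →
           app t s ⇒β^[ n + m ] app t' s'
  i-beta : ∀ {t t' s s' n m} → t ⇒β^[ n ] t' → s ⇒β^[ m ] s' →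
           app (lam t) s ⇒β^[ n + occ 0 t' * m + 1 ] (t' [ s' ])

_⇒β_ : Term → Term → Set
t ⇒β s = ∃[ n ] (t ⇒β^[ n ] s)

record IsMacroStepSystem {S : Set} (_→e_ _→¬e_ _⇒_ _⇒¬e_ : S → S → Set) : Set where
  field
    →¬e⊆⇒¬e   : ∀ {t u} → t →¬e u → t ⇒¬e u
    ⇒¬e⊆→¬e*  : ∀ {t u} → t ⇒¬e u → Star _→¬e_ t u
    merge      : ∀ {t s u} → t ⇒¬e s → s →e u → t ⇒ u
    split      : ∀ {t u} → t ⇒ u → ∃[ r ] (Star _→e_ t r × r ⇒¬e u)

module Submission where

-- After a small order theory of ℕ∞ and the usual
-- de Bruijn substitution algebra, two facts about levels are proved: the least
-- level deg t is a lower bound for the level of any parallel step out of t, and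
-- a parallel step strictly above deg t does not raise the least level (the
-- least-level redex survives).  Merge (1) then follows by absorbing a step of
-- level below the parallel step's level into the parallel step.  For the split
-- we annotate parallel steps with both their level and their index; the key
-- lemma extracts, from a parallel step of finite level d, a β-step of level d
-- followed by a parallel step whose index is one less and whose level is ≥ d.
-- Its β-redex case is a substitution lemma for the index, which is where the
-- occurrence count |t|ₓ enters.

open import Defs
open import Data.Nat using (ℕ; _<_; _∸_)
open import Data.Product using (_×_; ∃-syntax)
open import Data.Sum using (_⊎_)
open import Relation.Binary.Construct.Closure.ReflexiveTransitive using (Star)

open import Data.Nat using (zero; suc; _+_; _*_; _≤_; z≤n; s≤s; _≟_)
open import Data.Nat.Properties
  using (≤-refl; ≤-trans; <-≤-trans; ≤-<-trans; m≤n⇒m<n∨m≡n; m⊓n≤m; m⊓n≤n; ⊓-glb; ⊓-sel;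
         suc-injective; +-identityʳ; *-zeroʳ; m+n∸n≡m; +-∸-assoc; +-∸-comm; m≤m+n; m≤n+m)
open import Data.Nat.Solver using (module +-*-Solver)
open +-*-Solver using (solve; _:+_; _:*_; _:=_; con)
open import Data.Product using (_,_; proj₁; proj₂)
open import Data.Sum using (inj₁; inj₂)
open import Data.Empty using (⊥-elim)
open import Relation.Nullary using (yes; no)
open import Relation.Binary.PropositionalEquality
  using (_≡_; refl; sym; trans; cong; cong₂; subst; subst₂; module ≡-Reasoning)
open import Relation.Binary.Construct.Closure.ReflexiveTransitive using (ε; _◅_)

data _≤∞_ : ℕ∞ → ℕ∞ → Set where
  fin≤fin : ∀ {m n} → m ≤ n → fin m ≤∞ fin n
  ≤∞-top  : ∀ {x} → x ≤∞ ∞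

≤∞-refl : ∀ x → x ≤∞ x
≤∞-refl (fin n) = fin≤fin ≤-refl
≤∞-refl ∞ = ≤∞-top

≤∞-trans : ∀ {x y z} → x ≤∞ y → y ≤∞ z → x ≤∞ z
≤∞-trans (fin≤fin a) (fin≤fin b) = fin≤fin (≤-trans a b)
≤∞-trans _ ≤∞-top = ≤∞-top

<∞-≤∞-trans : ∀ {x y z} → x <∞ y → y ≤∞ z → x <∞ z
<∞-≤∞-trans (fin<fin a) (fin≤fin b) = fin<fin (<-≤-trans a b)
<∞-≤∞-trans (fin<fin _) ≤∞-top = fin<∞
<∞-≤∞-trans fin<∞ ≤∞-top = fin<∞

≤∞-<∞-trans : ∀ {x y z} → x ≤∞ y → y <∞ z → x <∞ z
≤∞-<∞-trans (fin≤fin a) (fin<fin b) = fin<fin (≤-<-trans a b)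
≤∞-<∞-trans (fin≤fin _) fin<∞ = fin<∞

≤∞⇒<∞⊎≡ : ∀ {x y} → x ≤∞ y → x <∞ y ⊎ x ≡ y
≤∞⇒<∞⊎≡ (fin≤fin a) with m≤n⇒m<n∨m≡n a
... | inj₁ b = inj₁ (fin<fin b)
... | inj₂ refl = inj₂ refl
≤∞⇒<∞⊎≡ {fin _} ≤∞-top = inj₁ fin<∞
≤∞⇒<∞⊎≡ {∞} ≤∞-top = inj₂ refl

fin0≤∞ : ∀ x → fin 0 ≤∞ x
fin0≤∞ (fin n) = fin≤fin z≤n
fin0≤∞ ∞ = ≤∞-top

min∞-≤ˡ : ∀ x y → min∞ x y ≤∞ x
min∞-≤ˡ (fin m) (fin n) = fin≤fin (m⊓n≤m m n)
min∞-≤ˡ (fin m) ∞ = fin≤fin ≤-refl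
min∞-≤ˡ ∞ y = ≤∞-top

min∞-≤ʳ : ∀ x y → min∞ x y ≤∞ y
min∞-≤ʳ (fin m) (fin n) = fin≤fin (m⊓n≤n m n)
min∞-≤ʳ (fin m) ∞ = ≤∞-top
min∞-≤ʳ ∞ y = ≤∞-refl y

min∞-glb : ∀ {x y z} → z ≤∞ x → z ≤∞ y → z ≤∞ min∞ x y
min∞-glb (fin≤fin a) (fin≤fin b) = fin≤fin (⊓-glb a b)
min∞-glb (fin≤fin a) ≤∞-top = fin≤fin a
min∞-glb ≤∞-top b = b

min∞-mono : ∀ {a b K H} → a ≤∞ K → b ≤∞ H → min∞ a b ≤∞ min∞ K H
min∞-mono {a} {b} p q = min∞-glb (≤∞-trans (min∞-≤ˡ a b) p) (≤∞-trans (min∞-≤ʳ a b) q)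

min∞-sel : ∀ x y → min∞ x y ≡ x ⊎ min∞ x y ≡ y
min∞-sel (fin m) (fin n) with ⊓-sel m n
... | inj₁ e = inj₁ (cong fin e)
... | inj₂ e = inj₂ (cong fin e)
min∞-sel (fin m) ∞ = inj₁ refl
min∞-sel ∞ y = inj₂ refl

min∞-strict : ∀ a b K H → min∞ a b <∞ min∞ K H →
              (a <∞ K × min∞ a b ≡ a) ⊎ (b <∞ H × min∞ a b ≡ b)
min∞-strict a b K H lt with min∞-sel a b
... | inj₁ e = inj₁ (<∞-≤∞-trans (subst (_<∞ min∞ K H) e lt) (min∞-≤ˡ K H) , e)
... | inj₂ e = inj₂ (<∞-≤∞-trans (subst (_<∞ min∞ K H) e lt) (min∞-≤ʳ K H) , e)

suc∞-mono : ∀ {x y} → x ≤∞ y → suc∞ x ≤∞ suc∞ y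
suc∞-mono (fin≤fin a) = fin≤fin (s≤s a)
suc∞-mono ≤∞-top = ≤∞-top

suc∞-<∞-inv : ∀ {x y} → suc∞ x <∞ suc∞ y → x <∞ y
suc∞-<∞-inv {fin _} {fin _} (fin<fin (s≤s a)) = fin<fin a
suc∞-<∞-inv {fin _} {∞} _ = fin<∞

suc∞≡fin : ∀ {h d} → suc∞ h ≡ fin d → ∃[ b ] (h ≡ fin b × suc b ≡ d)
suc∞≡fin {fin b} refl = b , refl , refl

-- A parallel application step of finite level d got that level from its head
-- or from its argument (one level deeper).
min∞-suc-cases : ∀ k h {d} → min∞ k (suc∞ h) ≡ fin d →
                 (k ≡ fin d × fin d ≤∞ suc∞ h) ⊎ ∃[ b ] (h ≡ fin b × suc b ≡ d × fin d ≤∞ k)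
min∞-suc-cases k h e with min∞-sel k (suc∞ h)
... | inj₁ e' = inj₁ (trans (sym e') e , subst (_≤∞ suc∞ h) e (min∞-≤ʳ k (suc∞ h)))
... | inj₂ e' with suc∞≡fin (trans (sym e') e)
...   | b , h≡b , sb≡d = inj₂ (b , h≡b , sb≡d , subst (_≤∞ k) e (min∞-≤ˡ k (suc∞ h)))

-- Substitution algebra for de Bruijn terms: renamings and substitutions act
-- extensionally and compose, which yields the commutation of a substitution
-- with the single substitution t [ s ] performed by a β-step.

ext-cong : ∀ {ρ ρ' : ℕ → ℕ} → (∀ x → ρ x ≡ ρ' x) → ∀ x → ext ρ x ≡ ext ρ' x
ext-cong h zero = refl
ext-cong h (suc x) = cong suc (h x)

ren-cong : ∀ {ρ ρ'} → (∀ x → ρ x ≡ ρ' x) → ∀ t → ren ρ t ≡ ren ρ' t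
ren-cong h (var x) = cong var (h x)
ren-cong h (lam t) = cong lam (ren-cong (ext-cong h) t)
ren-cong h (app t s) = cong₂ app (ren-cong h t) (ren-cong h s)

exts-cong : ∀ {σ σ' : ℕ → Term} → (∀ x → σ x ≡ σ' x) → ∀ x → exts σ x ≡ exts σ' x
exts-cong h zero = refl
exts-cong h (suc x) = cong (ren suc) (h x)

sub-cong : ∀ {σ σ'} → (∀ x → σ x ≡ σ' x) → ∀ t → sub σ t ≡ sub σ' t
sub-cong h (var x) = h x
sub-cong h (lam t) = cong lam (sub-cong (exts-cong h) t)
sub-cong h (app t s) = cong₂ app (sub-cong h t) (sub-cong h s)

ren-ren : ∀ ρ ρ' t → ren ρ (ren ρ' t) ≡ ren (λ x → ρ (ρ' x)) t
ren-ren ρ ρ' (var x) = refl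
ren-ren ρ ρ' (lam t) = cong lam (trans (ren-ren (ext ρ) (ext ρ') t) (ren-cong ext-comp t))
  where
  ext-comp : ∀ x → ext ρ (ext ρ' x) ≡ ext (λ x → ρ (ρ' x)) x
  ext-comp zero = refl
  ext-comp (suc x) = refl
ren-ren ρ ρ' (app t s) = cong₂ app (ren-ren ρ ρ' t) (ren-ren ρ ρ' s)

ren-sub : ∀ ρ σ t → ren ρ (sub σ t) ≡ sub (λ x → ren ρ (σ x)) t
ren-sub ρ σ (var x) = refl
ren-sub ρ σ (lam t) = cong lam (trans (ren-sub (ext ρ) (exts σ) t) (sub-cong ext-exts t))
  where
  ext-exts : ∀ x → ren (ext ρ) (exts σ x) ≡ exts (λ x → ren ρ (σ x)) x
  ext-exts zero = refl
  ext-exts (suc x) = trans (ren-ren (ext ρ) suc (σ x)) (sym (ren-ren suc ρ (σ x)))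
ren-sub ρ σ (app t s) = cong₂ app (ren-sub ρ σ t) (ren-sub ρ σ s)

sub-ren : ∀ σ ρ t → sub σ (ren ρ t) ≡ sub (λ x → σ (ρ x)) t
sub-ren σ ρ (var x) = refl
sub-ren σ ρ (lam t) = cong lam (trans (sub-ren (exts σ) (ext ρ) t) (sub-cong exts-ext t))
  where
  exts-ext : ∀ x → exts σ (ext ρ x) ≡ exts (λ x → σ (ρ x)) x
  exts-ext zero = refl
  exts-ext (suc x) = refl
sub-ren σ ρ (app t s) = cong₂ app (sub-ren σ ρ t) (sub-ren σ ρ s)

sub-sub : ∀ σ σ' t → sub σ (sub σ' t) ≡ sub (λ x → sub σ (σ' x)) t
sub-sub σ σ' (var x) = refl
sub-sub σ σ' (lam t) = cong lam (trans (sub-sub (exts σ) (exts σ') t) (sub-cong exts-exts t))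
  where
  exts-exts : ∀ x → sub (exts σ) (exts σ' x) ≡ exts (λ x → sub σ (σ' x)) x
  exts-exts zero = refl
  exts-exts (suc x) = trans (sub-ren (exts σ) suc (σ' x)) (sym (ren-sub suc σ (σ' x)))
sub-sub σ σ' (app t s) = cong₂ app (sub-sub σ σ' t) (sub-sub σ σ' s)

sub-id : ∀ t → sub var t ≡ t
sub-id (var x) = refl
sub-id (lam t) = cong lam (trans (sub-cong exts-var t) (sub-id t))
  where
  exts-var : ∀ x → exts var x ≡ var x
  exts-var zero = refl
  exts-var (suc x) = refl
sub-id (app t s) = cong₂ app (sub-id t) (sub-id s)

sub-single : ∀ τ c e → sub τ (c [ e ]) ≡ (sub (exts τ) c) [ sub τ e ]
sub-single τ c e =
  trans (sub-sub τ (single e) c)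
    (trans (sub-cong pointwise c) (sym (sub-sub (single (sub τ e)) (exts τ) c)))
  where
  pointwise : ∀ x → sub τ (single e x) ≡ sub (single (sub τ e)) (exts τ x)
  pointwise zero = refl
  pointwise (suc y) = sym (trans (sub-ren (single (sub τ e)) suc (τ y)) (sub-id (τ y)))

ren-single : ∀ ρ t s → ren ρ (t [ s ]) ≡ (ren (ext ρ) t) [ ren ρ s ]
ren-single ρ t s =
  trans (ren-sub ρ (single s) t)
    (trans (sub-cong pointwise t) (sym (sub-ren (single (ren ρ s)) (ext ρ) t)))
  where
  pointwise : ∀ x → ren ρ (single s x) ≡ single (ren ρ s) (ext ρ x)
  pointwise zero = refl
  pointwise (suc y) = refl

-- Counting free occurrences.  The counts needed are: occurrences are kept by
-- injective-on-the-variable renamings, and |c[e]|ⱼ = |c|ⱼ₊₁ + |c|₀·|e|ⱼ.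

occ-suc : ∀ x y → occ (suc x) (var (suc y)) ≡ occ x (var y)
occ-suc x y with x ≟ y | suc x ≟ suc y
... | yes _ | yes _ = refl
... | no _ | no _ = refl
... | yes p | no ¬q = ⊥-elim (¬q (cong suc p))
... | no ¬p | yes q = ⊥-elim (¬p (suc-injective q))

occ-ren : ∀ ρ x w → (∀ y → occ x (var (ρ y)) ≡ occ w (var y)) →
          ∀ t → occ x (ren ρ t) ≡ occ w t
occ-ren ρ x w h (var y) = h y
occ-ren ρ x w h (lam t) = occ-ren (ext ρ) (suc x) (suc w) h' t
  where
  h' : ∀ y → occ (suc x) (var (ext ρ y)) ≡ occ (suc w) (var y)
  h' zero = refl
  h' (suc y) = trans (occ-suc x (ρ y)) (trans (h y) (sym (occ-suc w y)))
occ-ren ρ x w h (app t s) = cong₂ _+_ (occ-ren ρ x w h t) (occ-ren ρ x w h s)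

occ-ren-avoid : ∀ ρ x → (∀ y → occ x (var (ρ y)) ≡ 0) → ∀ t → occ x (ren ρ t) ≡ 0
occ-ren-avoid ρ x h (var y) = h y
occ-ren-avoid ρ x h (lam t) = occ-ren-avoid (ext ρ) (suc x) h' t
  where
  h' : ∀ y → occ (suc x) (var (ext ρ y)) ≡ 0
  h' zero = refl
  h' (suc y) = trans (occ-suc x (ρ y)) (h y)
occ-ren-avoid ρ x h (app t s) = cong₂ _+_ (occ-ren-avoid ρ x h t) (occ-ren-avoid ρ x h s)

+-*-interchange : ∀ a b a' b' c → (a + b * c) + (a' + b' * c) ≡ (a + a') + (b + b') * c
+-*-interchange = solve 5 (λ a b a' b' c → (a :+ b :* c) :+ (a' :+ b' :* c) := (a :+ a') :+ (b :+ b') :* c) refl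

occ-sub : ∀ σ x w z c → (∀ y → occ x (σ y) ≡ occ w (var y) + occ z (var y) * c) →
          ∀ t → occ x (sub σ t) ≡ occ w t + occ z t * c
occ-sub σ x w z c h (var y) = h y
occ-sub σ x w z c h (lam t) = occ-sub (exts σ) (suc x) (suc w) (suc z) c h' t
  where
  h' : ∀ y → occ (suc x) (exts σ y) ≡ occ (suc w) (var y) + occ (suc z) (var y) * c
  h' zero = refl
  h' (suc y) rewrite occ-suc w y | occ-suc z y = trans (occ-ren suc (suc x) x (occ-suc x) (σ y)) (h y)
occ-sub σ x w z c h (app t s) =
  trans (cong₂ _+_ (occ-sub σ x w z c h t) (occ-sub σ x w z c h s))
        (+-*-interchange (occ w t) (occ z t) (occ w s) (occ z s) c)

occ-exts-0 : ∀ τ t → occ 0 (sub (exts τ) t) ≡ occ 0 t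
occ-exts-0 τ t =
  trans (occ-sub (exts τ) 0 0 0 0 h t)
    (trans (cong (occ 0 t +_) (*-zeroʳ (occ 0 t))) (+-identityʳ (occ 0 t)))
  where
  h : ∀ y → occ 0 (exts τ y) ≡ occ 0 (var y) + occ 0 (var y) * 0
  h zero = refl
  h (suc y) = occ-ren-avoid suc 0 (λ _ → refl) (τ y)

occ-single : ∀ j c e → occ j (c [ e ]) ≡ occ (suc j) c + occ 0 c * occ j e
occ-single j c e = occ-sub (single e) j (suc j) 0 (occ j e) h c
  where
  h : ∀ y → occ j (single e y) ≡ occ (suc j) (var y) + occ 0 (var y) * occ j e
  h zero = sym (+-identityʳ (occ j e))
  h (suc y) rewrite occ-suc j y = sym (+-identityʳ (occ j (var y)))

-- Parallel steps annotated with both their least level k and their index n: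
-- t ⇒⟨ k ∣ n ⟩ s.

data _⇒⟨_∣_⟩_ : Term → ℕ∞ → ℕ → Term → Set where
  a-var  : ∀ {x} → var x ⇒⟨ ∞ ∣ 0 ⟩ var x
  a-beta : ∀ {t t' s s' k h n m} → t ⇒⟨ k ∣ n ⟩ t' → s ⇒⟨ h ∣ m ⟩ s' →
           app (lam t) s ⇒⟨ fin 0 ∣ n + occ 0 t' * m + 1 ⟩ (t' [ s' ])
  a-app  : ∀ {t t' s s' k h n m} → t ⇒⟨ k ∣ n ⟩ t' → s ⇒⟨ h ∣ m ⟩ s' →
           app t s ⇒⟨ min∞ k (suc∞ h) ∣ n + m ⟩ app t' s'
  a-lam  : ∀ {t t' k n} → t ⇒⟨ k ∣ n ⟩ t' → lam t ⇒⟨ k ∣ n ⟩ lam t'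

forget-level : ∀ {t k n s} → t ⇒⟨ k ∣ n ⟩ s → t ⇒β^[ n ] s
forget-level a-var = i-var
forget-level (a-beta p q) = i-beta (forget-level p) (forget-level q)
forget-level (a-app p q) = i-app (forget-level p) (forget-level q)
forget-level (a-lam p) = i-lam (forget-level p)

forget-index : ∀ {t k n s} → t ⇒⟨ k ∣ n ⟩ s → t ⇒β[ k ] s
forget-index a-var = p-var
forget-index (a-beta p q) = p-beta (forget-index p) (forget-index q)
forget-index (a-app p q) = p-app (forget-index p) (forget-index q)
forget-index (a-lam p) = p-lam (forget-index p)

add-level : ∀ {t n s} → t ⇒β^[ n ] s → ∃[ k ] t ⇒⟨ k ∣ n ⟩ s
add-level i-var = _ , a-var
add-level (i-lam p) = _ , a-lam (proj₂ (add-level p))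
add-level (i-app p q) = _ , a-app (proj₂ (add-level p)) (proj₂ (add-level q))
add-level (i-beta p q) = _ , a-beta (proj₂ (add-level p)) (proj₂ (add-level q))

add-index : ∀ {t k s} → t ⇒β[ k ] s → ∃[ n ] t ⇒⟨ k ∣ n ⟩ s
add-index p-var = _ , a-var
add-index (p-lam p) = _ , a-lam (proj₂ (add-index p))
add-index (p-app p q) = _ , a-app (proj₂ (add-index p)) (proj₂ (add-index q))
add-index (p-beta p q) = _ , a-beta (proj₂ (add-index p)) (proj₂ (add-index q))

par⇒β : ∀ {t k s} → t ⇒β[ k ] s → t ⇒β s
par⇒β p = _ , forget-level (proj₂ (add-index p))

par-refl : ∀ t → t ⇒β[ ∞ ] t
par-refl (var x) = p-var
par-refl (lam t) = p-lam (par-refl t)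
par-refl (app t s) = p-app (par-refl t) (par-refl s)

step⇒par : ∀ {t d u} → t →β[ d ] u → t ⇒β[ fin d ] u
step⇒par (β-root {t} {s}) = p-beta (par-refl t) (par-refl s)
step⇒par (β-lam st) = p-lam (step⇒par st)
step⇒par (β-appL {s = s} st) = p-app (step⇒par st) (par-refl s)
step⇒par (β-appR {s = s} st) = p-app (par-refl s) (step⇒par st)

min∞-suc≡∞ : ∀ k h → min∞ k (suc∞ h) ≡ ∞ → k ≡ ∞ × h ≡ ∞
min∞-suc≡∞ ∞ ∞ refl = refl , refl
min∞-suc≡∞ (fin _) (fin _) ()
min∞-suc≡∞ (fin _) ∞ ()
min∞-suc≡∞ ∞ (fin _) ()

par∞-identity : ∀ {t k s} → t ⇒β[ k ] s → k ≡ ∞ → s ≡ t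
par∞-identity p-var _ = refl
par∞-identity (p-app {k = k} {h = h} p q) e =
  cong₂ app (par∞-identity p (proj₁ (min∞-suc≡∞ k h e)))
            (par∞-identity q (proj₂ (min∞-suc≡∞ k h e)))
par∞-identity (p-lam p) e = cong lam (par∞-identity p e)

deg-app≤ : ∀ t s → deg (app t s) ≤∞ min∞ (deg t) (suc∞ (deg s))
deg-app≤ (var x) s = ≤∞-refl _
deg-app≤ (app _ _) s = ≤∞-refl _
deg-app≤ (lam _) s = fin0≤∞ _

deg≤level : ∀ {t k s} → t ⇒β[ k ] s → deg t ≤∞ k
deg≤level p-var = ≤∞-top
deg≤level (p-beta _ _) = fin≤fin z≤n
deg≤level (p-lam p) = deg≤level p
deg≤level (p-app {t = t} {s = s} p q) =
  ≤∞-trans (deg-app≤ t s) (min∞-mono (deg≤level p) (suc∞-mono (deg≤level q)))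

-- Application case of the next lemma: the least level of app t s is attained
-- in a subterm reduced strictly above it, which keeps its least level.
deg-app-kept : ∀ {t t' s s' k h} →
               (deg t <∞ k → deg t' ≤∞ deg t) → (deg s <∞ h → deg s' ≤∞ deg s) →
               min∞ (deg t) (suc∞ (deg s)) <∞ min∞ k (suc∞ h) →
               deg (app t' s') ≤∞ min∞ (deg t) (suc∞ (deg s))
deg-app-kept {t} {t'} {s} {s'} {k} {h} keep-t keep-s lt
  with min∞-strict (deg t) (suc∞ (deg s)) k (suc∞ h) lt
... | inj₁ (t<k , e) =
  ≤∞-trans (deg-app≤ t' s') (≤∞-trans (min∞-≤ˡ _ _) (subst (deg t' ≤∞_) (sym e) (keep-t t<k)))
... | inj₂ (s<h , e) =
  ≤∞-trans (deg-app≤ t' s')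
    (≤∞-trans (min∞-≤ʳ _ _) (subst (suc∞ (deg s') ≤∞_) (sym e) (suc∞-mono (keep-s (suc∞-<∞-inv s<h)))))

-- A parallel step strictly above the least level does not raise it: a redex
-- of least level survives the step.
deg-kept : ∀ {t k s} → t ⇒β[ k ] s → deg t <∞ k → deg s ≤∞ deg t
deg-kept p-var _ = ≤∞-top
deg-kept (p-beta _ _) (fin<fin ())
deg-kept (p-lam p) lt = deg-kept p lt
deg-kept (p-app (p-lam _) _) _ = fin≤fin z≤n
deg-kept (p-app {t = t@(var _)} {t'} {s} {s'} {k} {h} p q) lt =
  deg-app-kept {t} {t'} {s} {s'} {k} {h} (deg-kept p) (deg-kept q) lt
deg-kept (p-app {t = t@(app _ _)} {t'} {s} {s'} {k} {h} p q) lt =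
  deg-app-kept {t} {t'} {s} {s'} {k} {h} (deg-kept p) (deg-kept q) lt

par-lam-inv : ∀ {t k w b'} → t ⇒β[ k ] w → w ≡ lam b' → fin 0 <∞ k →
              ∃[ b ] (t ≡ lam b × b ⇒β[ k ] b')
par-lam-inv (p-lam p) refl _ = _ , refl , p
par-lam-inv (p-beta _ _) _ (fin<fin ())

merge-par-step : ∀ {t k s j u} → t ⇒β[ k ] s → s →β[ j ] u → fin j <∞ k → t ⇒β u
merge-par-step (p-beta _ _) _ (fin<fin ())
merge-par-step (p-lam p) (β-lam st) lt with merge-par-step p st lt
... | n , r = n , i-lam r
merge-par-step (p-app {k = k} {h = h} p q) β-root lt
  with par-lam-inv p refl (<∞-≤∞-trans lt (min∞-≤ˡ k (suc∞ h)))
... | _ , refl , pb = _ , i-beta (proj₂ (par⇒β pb)) (proj₂ (par⇒β q))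
merge-par-step (p-app {k = k} {h = h} p q) (β-appL st) lt
  with merge-par-step p st (<∞-≤∞-trans lt (min∞-≤ˡ k (suc∞ h)))
... | _ , r = _ , i-app r (proj₂ (par⇒β q))
merge-par-step (p-app {k = k} {h = h} p q) (β-appR {k = j} st) lt
  with merge-par-step q st (suc∞-<∞-inv {fin j} {h} (<∞-≤∞-trans lt (min∞-≤ʳ k (suc∞ h))))
... | _ , r = _ , i-app (proj₂ (par⇒β p)) r

index-cast : ∀ {t n n' s} → n ≡ n' → t ⇒β^[ n ] s → t ⇒β^[ n' ] s
index-cast refl p = p

ren-indexed : ∀ ρ {a n a'} → a ⇒β^[ n ] a' → ren ρ a ⇒β^[ n ] ren ρ a'
ren-indexed ρ i-var = i-var
ren-indexed ρ (i-lam p) = i-lam (ren-indexed (ext ρ) p)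
ren-indexed ρ (i-app p q) = i-app (ren-indexed ρ p) (ren-indexed ρ q)
ren-indexed ρ (i-beta {t} {t'} {s} {s'} {n} {m} p q) =
  subst₂ (λ i b → ren ρ (app (lam t) s) ⇒β^[ i ] b)
    (cong (λ o → n + o * m + 1) (occ-ren (ext ρ) 0 0 binder-kept t'))
    (sym (ren-single ρ t' s'))
    (i-beta (ren-indexed (ext ρ) p) (ren-indexed ρ q))
  where
  binder-kept : ∀ y → occ 0 (var (ext ρ y)) ≡ occ 0 (var y)
  binder-kept zero = refl
  binder-kept (suc y) = refl

-- A parallel step σ ⇒ τ of substitutions in which variable j costs m and
-- every other variable costs nothing.
WeightedPar : (ℕ → Term) → (ℕ → Term) → ℕ → ℕ → Set
WeightedPar σ τ j m = ∀ x → σ x ⇒β^[ occ j (var x) * m ] τ x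

exts-weighted : ∀ {σ τ j m} → WeightedPar σ τ j m → WeightedPar (exts σ) (exts τ) (suc j) m
exts-weighted h zero = i-var
exts-weighted {j = j} {m} h (suc y) =
  index-cast (cong (_* m) (sym (occ-suc j y))) (ren-indexed suc (h y))

beta-index-arith : ∀ n A m O n' E → n + A * m + O * (n' + E * m) + 1 ≡ n + O * n' + 1 + (A + O * E) * m
beta-index-arith = solve 6 (λ n A m O n' E →
  n :+ A :* m :+ O :* (n' :+ E :* m) :+ con 1 := n :+ O :* n' :+ con 1 :+ (A :+ O :* E) :* m) refl

sub-indexed : ∀ {b n b' σ τ j m} → b ⇒β^[ n ] b' → WeightedPar σ τ j m →
              sub σ b ⇒β^[ n + occ j b' * m ] sub τ b'
sub-indexed i-var h = h _
sub-indexed (i-lam p) h = i-lam (sub-indexed p (exts-weighted h))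
sub-indexed {j = j} {m} (i-app {t' = t'} {s' = s'} {n = n} {m = n'} p q) h =
  index-cast (+-*-interchange n (occ j t') n' (occ j s') m) (i-app (sub-indexed p h) (sub-indexed q h))
sub-indexed {σ = σ} {τ} {j} {m} (i-beta {c} {c'} {e} {e'} {n} {n'} p q) h =
  subst₂ (λ i b → sub σ (app (lam c) e) ⇒β^[ i ] b) index-eq (sym (sub-single τ c' e'))
    (i-beta (sub-indexed p (exts-weighted h)) (sub-indexed q h))
  where
  open ≡-Reasoning
  index-eq : n + occ (suc j) c' * m + occ 0 (sub (exts τ) c') * (n' + occ j e' * m) + 1
             ≡ n + occ 0 c' * n' + 1 + occ j (c' [ e' ]) * m
  index-eq = begin
    n + occ (suc j) c' * m + occ 0 (sub (exts τ) c') * (n' + occ j e' * m) + 1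
      ≡⟨ cong (λ o → n + occ (suc j) c' * m + o * (n' + occ j e' * m) + 1) (occ-exts-0 τ c') ⟩
    n + occ (suc j) c' * m + occ 0 c' * (n' + occ j e' * m) + 1
      ≡⟨ beta-index-arith n (occ (suc j) c') m (occ 0 c') n' (occ j e') ⟩
    n + occ 0 c' * n' + 1 + (occ (suc j) c' + occ 0 c' * occ j e') * m
      ≡⟨ cong (λ o → n + occ 0 c' * n' + 1 + o * m) (sym (occ-single j c' e')) ⟩
    n + occ 0 c' * n' + 1 + occ j (c' [ e' ]) * m ∎

annotated-cast : ∀ {t k n n' s} → n ≡ n' → t ⇒⟨ k ∣ n ⟩ s → t ⇒⟨ k ∣ n' ⟩ s
annotated-cast refl p = p

extract-step : ∀ {t K n s d} → t ⇒⟨ K ∣ n ⟩ s → K ≡ fin d →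
               0 < n × ∃[ r ] (t →β[ d ] r × ∃[ k' ] (fin d ≤∞ k' × r ⇒⟨ k' ∣ n ∸ 1 ⟩ s))
extract-step (a-beta {t = b} {b'} {a} {a'} {n = n} {m} p q) refl =
  m≤n+m 1 _ , b [ a ] , β-root , _ , fin0≤∞ _ ,
  annotated-cast (sym (m+n∸n≡m _ 1)) (proj₂ (add-level contracted))
  where
  argument : WeightedPar (single a) (single a') 0 m
  argument zero = index-cast (sym (+-identityʳ m)) (forget-level q)
  argument (suc y) = i-var
  contracted : (b [ a ]) ⇒β^[ n + occ 0 b' * m ] (b' [ a' ])
  contracted = sub-indexed (forget-level p) argument
extract-step (a-lam p) e with extract-step p e
... | pos , r , st , k' , d≤k' , rest = pos , lam r , β-lam st , k' , d≤k' , a-lam rest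
extract-step (a-app {s = s} {k = k} {h = h} {n = n} {m = m} p q) e with min∞-suc-cases k h e
... | inj₁ (refl , d≤h+1) with extract-step p refl
...   | pos , r , st , k' , d≤k' , rest =
  ≤-trans pos (m≤m+n n m) , app r s , β-appL st , min∞ k' (suc∞ h) , min∞-glb d≤k' d≤h+1 ,
  annotated-cast (sym (+-∸-comm m pos)) (a-app rest q)
extract-step (a-app {t = t} {k = k} {h = h} {n = n} {m = m} p q) e
  | inj₂ (b , refl , refl , d≤k) with extract-step q refl
...   | pos , r , st , h' , b≤h' , rest =
  ≤-trans pos (m≤n+m m n) , app t r , β-appR st , min∞ k (suc∞ h') , min∞-glb d≤k (suc∞-mono b≤h') ,
  annotated-cast (sym (+-∸-assoc n pos)) (a-app p rest)

-- (1) Merge: the least-level step sits strictly below the non-least-level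
-- parallel step, because that step keeps the least level.
merge : ∀ (t s u : Term) → t ⇒¬ℓℓ s → s →ℓℓ u → t ⇒β u
merge t s u (k , p , above) (j , st , j≡deg) = merge-par-step p st (j<k above)
  where
  j<k : k ≡ ∞ ⊎ deg t <∞ k → fin j <∞ k
  j<k (inj₁ refl) = fin<∞
  j<k (inj₂ lt) = ≤∞-<∞-trans (subst (_≤∞ deg t) (sym j≡deg) (deg-kept p lt)) lt

-- (2) Indexed split: a parallel step is either above the least level or, by
-- extraction, starts with a least-level step.
split-annotated : ∀ {t s n} k → t ⇒⟨ k ∣ n ⟩ s →
                  t ⇒¬ℓℓ s ⊎ (0 < n × ∃[ r ] (t →ℓℓ r × r ⇒β^[ n ∸ 1 ] s))
split-annotated ∞ p = inj₁ (∞ , forget-index p , inj₁ refl)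
split-annotated (fin d) p with ≤∞⇒<∞⊎≡ (deg≤level (forget-index p))
... | inj₁ lt = inj₁ (fin d , forget-index p , inj₂ lt)
... | inj₂ e with extract-step p refl
...   | pos , r , st , _ , _ , rest = inj₂ (pos , r , (d , st , sym e) , forget-level rest)

indexed-split : ∀ (t s : Term) (n : ℕ) → t ⇒β^[ n ] s →
                t ⇒¬ℓℓ s ⊎ (0 < n × ∃[ r ] (t →ℓℓ r × r ⇒β^[ n ∸ 1 ] s))
indexed-split t s n p = split-annotated _ (proj₂ (add-level p))

split-indexed : ∀ n {t s} → t ⇒β^[ n ] s → ∃[ r ] (Star _→ℓℓ_ t r × r ⇒¬ℓℓ s)
split-indexed n {t} {s} p with indexed-split t s n p
... | inj₁ nonleast = t , ε , nonleast
split-indexed zero p | inj₂ (() , _)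
split-indexed (suc n) p | inj₂ (_ , r , st , rest) with split-indexed n rest
... | r' , steps , nonleast = r' , st ◅ steps , nonleast

split : ∀ (t s : Term) → t ⇒β s → ∃[ r ] (Star _→ℓℓ_ t r × r ⇒¬ℓℓ s)
split t s (n , p) = split-indexed n p

-- A non-least-level parallel step is a sequence of non-least-level steps:
-- extract one step at a time; the remaining step stays above the least level
-- since that level is kept by the extracted step.
nonleast⇒steps : ∀ n {t k s} → t ⇒⟨ k ∣ n ⟩ s → k ≡ ∞ ⊎ deg t <∞ k → Star _→¬ℓℓ_ t s
nonleast⇒steps n {t} {∞} p _ = subst (Star _→¬ℓℓ_ t) (sym (par∞-identity (forget-index p) refl)) ε
nonleast⇒steps n {k = fin d} p (inj₁ ())
nonleast⇒steps n {k = fin d} p (inj₂ lt) with extract-step p refl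
nonleast⇒steps zero {k = fin d} p (inj₂ lt) | () , _
nonleast⇒steps (suc n) {k = fin d} p (inj₂ lt) | _ , r , st , k' , d≤k' , rest =
  (d , st , lt) ◅ nonleast⇒steps n rest (inj₂ (≤∞-<∞-trans (deg-kept (step⇒par st) lt) (<∞-≤∞-trans lt d≤k')))

proposition10 : (∀ (t s u : Term) → t ⇒¬ℓℓ s → s →ℓℓ u → t ⇒β u)
    × (∀ (t s : Term) (n : ℕ) → t ⇒β^[ n ] s →
    t ⇒¬ℓℓ s ⊎ (0 < n × ∃[ r ] (t →ℓℓ r × r ⇒β^[ n ∸ 1 ] s)))
    × (∀ (t s : Term) → t ⇒β s → ∃[ r ] (Star _→ℓℓ_ t r × r ⇒¬ℓℓ s))
    × IsMacroStepSystem _→ℓℓ_ _→¬ℓℓ_ _⇒β_ _⇒¬ℓℓ_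
proposition10 = merge , indexed-split , split , record
  { →¬e⊆⇒¬e = λ { (k , st , lt) → fin k , step⇒par st , inj₂ lt }
  ; ⇒¬e⊆→¬e* = λ { (k , p , above) → nonleast⇒steps _ (proj₂ (add-index p)) above }
  ; merge = λ {t} {s} {u} → merge t s u
  ; split = λ {t} {u} → split t u
  }
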